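{- Let $A$ be a type, $P : A \to \mathsf{Prop}$ a predicate, and $j : \mathsf{Prop} \to \mathsf{Prop}$ a modality. Then $j$ forces $P$ (i.e. $\forall a{:}A.\; j(P\,a)$ holds) if and only if $\mathcal{O}_P \le j$, i.e. $\forall s{:}\mathsf{Prop}.\; \mathcal{O}_P\, s \Rightarrow j\, s$.
   Context: We work in the Calculus of Inductive Constructions with an impredicative universe $\mathsf{Prop}$ of proof-irrelevant propositions (one may eliminate from propositions only into propositions), together with function extensionality, propositional extensionality, uniqueness of proofs of propositions, and definite description. A modality is a map $j : \mathsf{Prop} \to \mathsf{Prop}$ that is monotone ($(p \Rightarrow q) \Rightarrow (j\,p \Rightarrow j\,q)$), inflationary ($p \Rightarrow j\,p$) and idempotent ($j(j\,p) \Rightarrow j\,p$). Modalities are ordered pointwise: $j \le k$ iff $\forall p.\; j\,p \Rightarrow k\,p$. For $P : A \to \mathsf{Prop}$, the oracle modality $\mathcal{O}_P : \mathsf{Prop}\to\mathsf{Prop}$ is defined at $s:\mathsf{Prop}$ as the inductive proposition generated by the constructors $\mathsf{prf} : s \to \mathcal{O}_P\,s$ and $\mathsf{ask} : \prod_{a:A} (P\,a \to \mathcal{O}_P\,s) \to \mathcal{O}_P\,s$; equivalently $\mathcal{O}_P\,s \iff \forall r{:}\mathsf{Prop}.\,(s\Rightarrow r)\Rightarrow(\forall a{:}A.\,(P\,a\Rightarrow r)\Rightarrow r)\Rightarrow r$. It is a modality. -}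

module Defs where

-- Propositions are rendered as types in Set (propositions-as-types).

record IsModality (j : Set → Set) : Set₁ where
  field
    monotone     : {p q : Set} → (p → q) → j p → j q
    inflationary : {p : Set} → p → j p
    idempotent   : {p : Set} → j (j p) → j p

_≤ₘ_ : (Set → Set) → (Set → Set) → Set₁
j ≤ₘ k = (p : Set) → j p → k p

Forces : (j : Set → Set) {A : Set} → (A → Set) → Set
Forces j {A} P = (a : A) → j (P a)

data Oracle {A : Set} (P : A → Set) (s : Set) : Set where
  prf : s → Oracle P s
  ask : (a : A) → (P a → Oracle P s) → Oracle P s

module Submission where

open import Defs
open import Data.Product using (_×_; _,_)

-- O_P is the least modality forcing P: it forces P by a single query, and any
-- modality j forcing P interprets each query by binding (monotone, then idempotent).

Oracle-forces : {A : Set} (P : A → Set) → Forces (Oracle P) P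
Oracle-forces P a = ask a prf

≤ₘ-preserves-Forces : {A : Set} {P : A → Set} {j k : Set → Set} →
                      j ≤ₘ k → Forces j P → Forces k P
≤ₘ-preserves-Forces {P = P} j≤k forces a = j≤k (P a) (forces a)

module _ {A : Set} {P : A → Set} {j : Set → Set} (isModality : IsModality j)
         (forces : Forces j P) where
  open IsModality isModality

  Oracle-≤ₘ : Oracle P ≤ₘ j
  Oracle-≤ₘ s (prf x)   = inflationary x
  Oracle-≤ₘ s (ask a k) = idempotent (monotone (λ pa → Oracle-≤ₘ s (k pa)) (forces a))

proposition6 : (A : Set) (P : A → Set) (j : Set → Set) → IsModality j →
    (Forces j P → Oracle P ≤ₘ j) × (Oracle P ≤ₘ j → Forces j P)
proposition6 A P j isModality =
  Oracle-≤ₘ isModality , λ O≤j → ≤ₘ-preserves-Forces O≤j (Oracle-forces P)
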